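{- Let $p$ be prime, $k\in\mathbb{N}$ and $n\in\mathbb{N}$ with $n\geq 2$. Then $$\operatorname{rank}(\mathcal{A}^*_{p^k,n})\leq\operatorname{rank}(W^*_{p^k,n+1})\leq 2(k+1)\cdot\operatorname{rank}(\mathcal{A}^*_{p^k,n}),$$ ranks over $\mathbb{Z}/p\mathbb{Z}$.
   Context: Let $R=\mathbb{Z}/p^k\mathbb{Z}$, $\langle x,y\rangle=\sum_i x_iy_i\in R$. For $m\geq1$, $\mathbb{P}R^{m-1}$ is the set of vectors of $R^m$ with at least one invertible coordinate modulo $b\sim\lambda b$, $\lambda\in R^\times$. For $a\in R^m$, $b\in\mathbb{P}R^{m-1}$: $H_b(a)=\{x\in R^m:\langle x-a,b\rangle=0\text{ in }R\}$, $H_b=H_b(0)$. $W^*_{p^k,m}$ has rows indexed by $b\in\mathbb{P}R^{m-1}$, columns by $x\in R^m$, entry $1$ iff $x\in H_b$. $\mathcal{A}^*_{p^k,m}$ has rows indexed by $(a,b)\in R^m\times\mathbb{P}R^{m-1}$, columns by $x\in R^m$, entry $1$ iff $x\in H_b(a)$. Entries $0$ otherwise. -}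

module Defs where

open import Data.Nat using (ℕ; zero; suc; _+_; _*_; _≤_; ∣_-_∣)
open import Data.Nat.Divisibility using (_∣_; _∣?_)
open import Data.Fin using (Fin; toℕ; _<_) renaming (zero to fzero; suc to fsuc)
open import Data.Product using (Σ; _×_; _,_)
open import Relation.Nullary using (¬_; does)
open import Data.Bool using (if_then_else_)

sumFin : (n : ℕ) → (Fin n → ℕ) → ℕ
sumFin zero    f = 0
sumFin (suc n) f = f fzero + sumFin n (λ i → f (fsuc i))

-- The ring R = ℤ/qℤ, elements represented by Fin q (q = p^k).
-- Equality in R of two naturals:  u ≡ v (mod q).
EqR : (q : ℕ) → ℕ → ℕ → Set
EqR q u v = q ∣ ∣ u - v ∣

IsUnit : (q : ℕ) → Fin q → Set
IsUnit q u = Σ (Fin q) λ v → EqR q (toℕ u * toℕ v) 1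

Vecʳ : ℕ → ℕ → Set
Vecʳ q m = Fin m → Fin q

-- Inner product ⟨x , b⟩ computed in ℕ (to be read modulo q).
dot : (q m : ℕ) → Vecʳ q m → Vecʳ q m → ℕ
dot q m x b = sumFin m (λ i → toℕ (x i) * toℕ (b i))

-- Points of ℙR^{m-1}: one canonical representative per class b ~ λb.
-- b has an invertible coordinate; letting i be the first invertible
-- coordinate, we normalise b_i = 1 (scaling by a unit preserves which
-- coordinates are invertible, so each class has exactly one such rep).
record ProjPt (q m : ℕ) : Set where
  constructor proj
  field
    vec      : Vecʳ q m
    idx      : Fin m
    idxUnit  : IsUnit q (vec idx)
    before   : ∀ j → j < idx → ¬ IsUnit q (vec j)
    normed   : EqR q (toℕ (vec idx)) 1
open ProjPt public

indicT : (q m : ℕ) → ℕ → ProjPt q m → Vecʳ q m → ℕ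
indicT q m t b x = if does (q ∣? ∣ dot q m x (vec b) - t ∣) then 1 else 0

Matrix : Set → Set → Set
Matrix Row Col = Row → Col → ℕ

WStar : (q m : ℕ) → Matrix (ProjPt q m) (Vecʳ q m)
WStar q m b x = indicT q m 0 b x

-- A*_{q,m}: rows (a , b) ∈ R^m × ℙR^{m-1}, columns x ∈ R^m,
-- entry 1 iff x ∈ H_b(a), i.e. ⟨x - a , b⟩ = 0, i.e. ⟨x,b⟩ ≡ ⟨a,b⟩ (mod q).
AStar : (q m : ℕ) → Matrix (Vecʳ q m × ProjPt q m) (Vecʳ q m)
AStar q m (a , b) x = indicT q m (dot q m a (vec b)) b x

Independent : (p : ℕ) {Row Col : Set} → Matrix Row Col →
              (t : ℕ) → (Fin t → Row) → Set
Independent p {Row} {Col} M t rs =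
  (c : Fin t → ℕ) →
  (∀ (x : Col) → p ∣ sumFin t (λ i → c i * M (rs i) x)) →
  ∀ i → p ∣ c i

HasRank : (p : ℕ) {Row Col : Set} → Matrix Row Col → ℕ → Set
HasRank p {Row} M r =
  Σ (Fin r → Row) (λ rs → Independent p M r rs) ×
  (∀ (rs : Fin (suc r) → Row) → ¬ Independent p M (suc r) rs)

module Submission where

-- Lower bound: since ⟨x - a , b⟩ = ⟨(x , 1) , (b , -⟨a , b⟩)⟩, the row (a , b) of A* is the row
-- (b , -⟨a , b⟩) of W* restricted to the columns (x , 1), so independent rows of A* stay
-- independent in W*.
--
-- Upper bound: a point b of ℙR^n has a coordinate c ∈ {0 , 1} other than its first invertible
-- one; deleting it leaves a point b' of ℙR^(n-1), and ⟨y , b⟩ = y_c b_c + ⟨ŷ , b'⟩ with ŷ the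
-- vector y without coordinate c. Writing y_c = p^j w with w a unit, ⟨y , b⟩ = 0 iff
-- ⟨w⁻¹ ŷ , b'⟩ = -p^j b_c. So on the columns with given c and j, the row b of W* is a row
-- (a , b') of A* read through the column map y ↦ w⁻¹ ŷ. Hence every row of W* lies in the span
-- of the 2 (k + 1) rank(A*) vectors y ↦ [j(y) = j] A*_(S i) (w⁻¹ ŷ), S a basis of the rows of
-- A*. Maximality of S only yields spanning coefficients under a double negation, which is
-- discharged because ≤ on ℕ is decidable.

open import Defs

open import Data.Bool using (if_then_else_)
open import Data.Empty using (⊥-elim)
open import Data.Fin as Fin
  using (Fin; toℕ; _↑ˡ_; _↑ʳ_; combine; punchIn; finToFun; funToFin)
  renaming (zero to fzero; suc to fsuc)
import Data.Fin.Properties as Finₚ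
open import Data.Integer as ℤ using (ℤ; +_) renaming (_+_ to _+ᶻ_; _*_ to _*ᶻ_; -_ to -ᶻ_)
import Data.Integer.Properties as ℤₚ
import Data.Integer.Tactic.RingSolver as ℤ-Solver
open import Data.List using (_∷_; [])
open import Data.Nat as ℕ
  using (ℕ; zero; suc; _+_; _*_; _∸_; _^_; _≤_; _<_; ∣_-_∣; s≤s; z<s; s<s; NonZero)
open import Data.Nat.Coprimality as Coprime using (Coprime)
open import Data.Nat.Divisibility as ∣ using (_∣_; divides; _∣?_)
open import Data.Nat.DivMod using (_mod_; _divMod_; DivMod)
open import Data.Nat.GCD using (module Bézout)
open import Data.Nat.Primality using (Prime; prime⇒irreducible; prime⇒nonZero; prime⇒nonTrivial)
import Data.Nat.Properties as ℕₚ
import Data.Nat.Tactic.RingSolver as ℕ-Solver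
open import Data.Product using (∃; ∃₂; ∃-syntax; Σ-syntax; _×_; _,_; proj₁; proj₂; uncurry)
open import Data.Sum using (inj₁; inj₂)
import Data.Vec.Functional as Vector
open import Data.Vec.Functional using (removeAt; insertAt)
import Data.Vec.Functional.Properties as Vectorₚ
open import Function using (_∘_)
open import Function.Bundles using (Equivalence; _⇔_; mk⇔)
open import Function.Construct.Composition using (_⇔-∘_)
open import Function.Construct.Symmetry using (⇔-sym)
open import Relation.Binary.Bundles using (Setoid)
open import Relation.Binary.PropositionalEquality
  using (_≡_; _≢_; refl; sym; trans; cong; cong₂; subst; module ≡-Reasoning)
import Relation.Binary.Reasoning.Setoid as SetoidReasoning
open import Relation.Nullary using (¬_; Dec; does; yes; no)
open import Relation.Nullary.Decidable using (dec-true; dec-false; decidable-stable; does-⇔)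
open import Relation.Nullary.Negation using (¬¬-map)

open import Algebra.Properties.Semiring.Sum ℕₚ.+-*-semiring
  using (sum; sum-cong-≗; ∑-distrib-+; ∑-comm; *-distribˡ-sum; *-distribʳ-sum; sum-remove; sum-replicate-zero)

-- Congruences modulo m

infix 4 _≡_[mod_]

-- A record rather than a Σ-type, so that a, b and m can be inferred from a congruence.
record _≡_[mod_] (a b m : ℕ) : Set where
  constructor congruent
  field
    quotient : ℤ
    property : + a ≡ + b +ᶻ quotient *ᶻ + m

module _ {m : ℕ} where

  mod-refl : ∀ {a} → a ≡ a [mod m ]
  mod-refl {a} = congruent (+ 0) (sym (ℤₚ.+-identityʳ (+ a)))

  mod-reflexive : ∀ {a b} → a ≡ b → a ≡ b [mod m ]
  mod-reflexive refl = mod-refl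

  mod-sym : ∀ {a b} → a ≡ b [mod m ] → b ≡ a [mod m ]
  mod-sym {a} {b} (congruent t e) = congruent (-ᶻ t) (lemma (+ b) t (+ m) (+ a) e)
    where
    lemma : ∀ b t m a → a ≡ b +ᶻ t *ᶻ m → b ≡ a +ᶻ (-ᶻ t) *ᶻ m
    lemma b t m .(b +ᶻ t *ᶻ m) refl = ℤ-Solver.solve (b ∷ t ∷ m ∷ [])

  mod-trans : ∀ {a b c} → a ≡ b [mod m ] → b ≡ c [mod m ] → a ≡ c [mod m ]
  mod-trans {a} {b} {c} (congruent t e) (congruent s f) = congruent (s +ᶻ t) (lemma (+ c) s t (+ m) (+ b) (+ a) e f)
    where
    lemma : ∀ c s t m b a → a ≡ b +ᶻ t *ᶻ m → b ≡ c +ᶻ s *ᶻ m → a ≡ c +ᶻ (s +ᶻ t) *ᶻ m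
    lemma c s t m .(c +ᶻ s *ᶻ m) .((c +ᶻ s *ᶻ m) +ᶻ t *ᶻ m) refl refl = ℤ-Solver.solve (c ∷ s ∷ t ∷ m ∷ [])

  +-cong-mod : ∀ {a b c d} → a ≡ b [mod m ] → c ≡ d [mod m ] → a + c ≡ b + d [mod m ]
  +-cong-mod {a} {b} {c} {d} (congruent t e) (congruent s f) = congruent (t +ᶻ s) (begin
    + (a + c)                       ≡⟨ ℤₚ.pos-+ a c ⟩
    + a +ᶻ + c                      ≡⟨ lemma (+ b) (+ d) t s (+ m) (+ a) (+ c) e f ⟩
    (+ b +ᶻ + d) +ᶻ (t +ᶻ s) *ᶻ + m ≡⟨ cong (_+ᶻ (t +ᶻ s) *ᶻ + m) (ℤₚ.pos-+ b d) ⟨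
    + (b + d) +ᶻ (t +ᶻ s) *ᶻ + m    ∎)
    where
    open ≡-Reasoning
    lemma : ∀ b d t s m a c → a ≡ b +ᶻ t *ᶻ m → c ≡ d +ᶻ s *ᶻ m → a +ᶻ c ≡ (b +ᶻ d) +ᶻ (t +ᶻ s) *ᶻ m
    lemma b d t s m .(b +ᶻ t *ᶻ m) .(d +ᶻ s *ᶻ m) refl refl = ℤ-Solver.solve (b ∷ d ∷ t ∷ s ∷ m ∷ [])

  *-cong-mod : ∀ {a b c d} → a ≡ b [mod m ] → c ≡ d [mod m ] → a * c ≡ b * d [mod m ]
  *-cong-mod {a} {b} {c} {d} (congruent t e) (congruent s f) = congruent w (begin
    + (a * c)                ≡⟨ ℤₚ.pos-* a c ⟩
    + a *ᶻ + c               ≡⟨ lemma (+ b) (+ d) t s (+ m) (+ a) (+ c) e f ⟩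
    (+ b *ᶻ + d) +ᶻ w *ᶻ + m ≡⟨ cong (_+ᶻ w *ᶻ + m) (ℤₚ.pos-* b d) ⟨
    + (b * d) +ᶻ w *ᶻ + m    ∎)
    where
    open ≡-Reasoning
    w : ℤ
    w = t *ᶻ + d +ᶻ + b *ᶻ s +ᶻ t *ᶻ s *ᶻ + m
    lemma : ∀ b d t s m a c → a ≡ b +ᶻ t *ᶻ m → c ≡ d +ᶻ s *ᶻ m →
            a *ᶻ c ≡ (b *ᶻ d) +ᶻ (t *ᶻ d +ᶻ b *ᶻ s +ᶻ t *ᶻ s *ᶻ m) *ᶻ m
    lemma b d t s m .(b +ᶻ t *ᶻ m) .(d +ᶻ s *ᶻ m) refl refl = ℤ-Solver.solve (b ∷ d ∷ t ∷ s ∷ m ∷ [])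

  +-cancelʳ-mod : ∀ {a b c} → a + c ≡ b + c [mod m ] → a ≡ b [mod m ]
  +-cancelʳ-mod {a} {b} {c} (congruent t e) = congruent t (lemma (+ a) (+ b) (+ c) t (+ m)
    (trans (sym (ℤₚ.pos-+ a c)) (trans e (cong (_+ᶻ t *ᶻ + m) (ℤₚ.pos-+ b c)))))
    where
    lemma : ∀ a b c t m → a +ᶻ c ≡ (b +ᶻ c) +ᶻ t *ᶻ m → a ≡ b +ᶻ t *ᶻ m
    lemma a b c t m e = begin
      a                                  ≡⟨ ℤ-Solver.solve (a ∷ c ∷ []) ⟩
      (a +ᶻ c) ℤ.- c                     ≡⟨ cong (ℤ._- c) e ⟩
      ((b +ᶻ c) +ᶻ t *ᶻ m) ℤ.- c         ≡⟨ ℤ-Solver.solve (b ∷ c ∷ t ∷ m ∷ []) ⟩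
      b +ᶻ t *ᶻ m                        ∎
      where open ≡-Reasoning

  n*m≡0-mod : ∀ n → n * m ≡ 0 [mod m ]
  n*m≡0-mod n = congruent (+ n) (trans (ℤₚ.pos-* n m) (sym (ℤₚ.+-identityˡ _)))

  ∣⇒≡0-mod : ∀ {a} → m ∣ a → a ≡ 0 [mod m ]
  ∣⇒≡0-mod (divides n refl) = n*m≡0-mod n

  ≡0-mod⇒∣ : ∀ {a} → a ≡ 0 [mod m ] → m ∣ a
  ≡0-mod⇒∣ (congruent t e) =
    divides ℤ.∣ t ∣ (trans (cong ℤ.∣_∣ (trans e (ℤₚ.+-identityˡ (t *ᶻ + m)))) (ℤₚ.abs-* t (+ m)))

  ∣∸⇔≡-mod : ∀ {a b} → b ≤ a → (m ∣ a ∸ b) ⇔ (a ≡ b [mod m ])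
  ∣∸⇔≡-mod {a} {b} b≤a = mk⇔ to from
    where
    a∸b+b≡a : a ∸ b + b ≡ a
    a∸b+b≡a = ℕₚ.m∸n+n≡m b≤a
    to : m ∣ a ∸ b → a ≡ b [mod m ]
    to m∣a∸b = subst (_≡ b [mod m ]) a∸b+b≡a (+-cong-mod (∣⇒≡0-mod m∣a∸b) (mod-refl {b}))
    from : a ≡ b [mod m ] → m ∣ a ∸ b
    from a≡b = ≡0-mod⇒∣ (+-cancelʳ-mod {c = b} (subst (_≡ 0 + b [mod m ]) (sym a∸b+b≡a) a≡b))

  EqR⇔≡-mod : ∀ {a b} → EqR m a b ⇔ a ≡ b [mod m ]
  EqR⇔≡-mod {a} {b} with ℕₚ.≤-total b a
  ... | inj₁ b≤a = subst (λ d → (m ∣ d) ⇔ (a ≡ b [mod m ])) (sym (ℕₚ.m≤n⇒∣n-m∣≡n∸m b≤a)) (∣∸⇔≡-mod b≤a)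
  ... | inj₂ a≤b = subst (λ d → (m ∣ d) ⇔ (a ≡ b [mod m ])) (sym (ℕₚ.m≤n⇒∣m-n∣≡n∸m a≤b))
                     (mk⇔ (mod-sym ∘ Equivalence.to b∸a) (Equivalence.from b∸a ∘ mod-sym))
    where
    b∸a : (m ∣ b ∸ a) ⇔ (b ≡ a [mod m ])
    b∸a = ∣∸⇔≡-mod a≤b

mod-setoid : ℕ → Setoid _ _
mod-setoid m = record
  { Carrier       = ℕ
  ; _≈_           = λ a b → a ≡ b [mod m ]
  ; isEquivalence = record { refl = mod-refl ; sym = mod-sym ; trans = mod-trans }
  }

module ≡-mod-Reasoning (m : ℕ) = SetoidReasoning (mod-setoid m)

module _ {m : ℕ} where

  +-congˡ-mod : ∀ a {b c} → b ≡ c [mod m ] → a + b ≡ a + c [mod m ]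
  +-congˡ-mod a = +-cong-mod (mod-refl {a = a})

  +-congʳ-mod : ∀ a {b c} → b ≡ c [mod m ] → b + a ≡ c + a [mod m ]
  +-congʳ-mod a b≡c = +-cong-mod b≡c (mod-refl {a = a})

  *-congˡ-mod : ∀ a {b c} → b ≡ c [mod m ] → a * b ≡ a * c [mod m ]
  *-congˡ-mod a = *-cong-mod (mod-refl {a = a})

  *-congʳ-mod : ∀ a {b c} → b ≡ c [mod m ] → b * a ≡ c * a [mod m ]
  *-congʳ-mod a b≡c = *-cong-mod b≡c (mod-refl {a = a})

  x+n*m≡x-mod : ∀ x n → x + n * m ≡ x [mod m ]
  x+n*m≡x-mod x n = subst (x + n * m ≡_[mod m ]) (ℕₚ.+-identityʳ x) (+-congˡ-mod x (n*m≡0-mod n))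

  ≡-mod⇒≡ : ∀ {a b} → a < m → b < m → a ≡ b [mod m ] → a ≡ b
  ≡-mod⇒≡ {a} {b} a<m b<m a≡b = ℕₚ.∣m-n∣≡0⇒m≡n (small-multiple (Equivalence.from EqR⇔≡-mod a≡b))
    where
    small-multiple : m ∣ ∣ a - b ∣ → ∣ a - b ∣ ≡ 0
    small-multiple (divides zero e) = e
    small-multiple (divides (suc n) e) =
      ⊥-elim (ℕₚ.<⇒≱ (ℕₚ.≤-<-trans (ℕₚ.∣m-n∣≤m⊔n a b) (ℕₚ.⊔-lub a<m b<m))
                     (subst (m ≤_) (sym e) (ℕₚ.m≤m+n m (n * m))))

  x+[m∸1]*x≡0-mod : .{{NonZero m}} → ∀ x → x + (m ∸ 1) * x ≡ 0 [mod m ]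
  x+[m∸1]*x≡0-mod x = subst (_≡ 0 [mod m ]) (sym x+[m∸1]*x≡x*m) (n*m≡0-mod x)
    where
    x+[m∸1]*x≡x*m : x + (m ∸ 1) * x ≡ x * m
    x+[m∸1]*x≡x*m = begin
      x + (m ∸ 1) * x   ≡⟨⟩
      (1 + (m ∸ 1)) * x ≡⟨ cong (_* x) (ℕₚ.m+[n∸m]≡n (ℕ.>-nonZero⁻¹ m)) ⟩
      m * x             ≡⟨ ℕₚ.*-comm m x ⟩
      x * m             ∎
      where open ≡-Reasoning

  +≡0-mod-unique : ∀ {a t x} → a + t ≡ 0 [mod m ] → (x + t ≡ 0 [mod m ]) ⇔ (x ≡ a [mod m ])
  +≡0-mod-unique {a} {t} {x} a+t≡0 = mk⇔
    (λ x+t≡0 → +-cancelʳ-mod (mod-trans x+t≡0 (mod-sym a+t≡0)))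
    (λ x≡a → mod-trans (+-congʳ-mod t x≡a) a+t≡0)

  *-unit-≡0-mod : ∀ {u u' x} → u * u' ≡ 1 [mod m ] → (x ≡ 0 [mod m ]) ⇔ (u' * x ≡ 0 [mod m ])
  *-unit-≡0-mod {u} {u'} {x} uu'≡1 = mk⇔
    (λ x≡0 → subst (u' * x ≡_[mod m ]) (ℕₚ.*-zeroʳ u') (*-congˡ-mod u' x≡0))
    (λ u'x≡0 → begin
      x              ≡⟨ ℕₚ.*-identityˡ x ⟨
      1 * x          ≈⟨ *-congʳ-mod x uu'≡1 ⟨
      u * u' * x     ≡⟨ ℕₚ.*-assoc u u' x ⟩
      u * (u' * x)   ≈⟨ *-congˡ-mod u u'x≡0 ⟩
      u * 0          ≡⟨ ℕₚ.*-zeroʳ u ⟩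
      0              ∎)
    where open ≡-mod-Reasoning m

  unit-coefficient-mod : .{{NonZero m}} → ∀ {c e a t} → c * e ≡ 1 [mod m ] → c * a + t ≡ 0 [mod m ] →
    a ≡ (m ∸ 1) * (e * t) [mod m ]
  unit-coefficient-mod {c} {e} {a} {t} ce≡1 ca+t≡0 = Equivalence.to (+≡0-mod-unique [m∸1]et+et≡0) a+et≡0
    where
    open ≡-mod-Reasoning m
    a+et≡0 : a + e * t ≡ 0 [mod m ]
    a+et≡0 = begin
      a + e * t           ≡⟨ cong (_+ e * t) (ℕₚ.*-identityˡ a) ⟨
      1 * a + e * t       ≈⟨ +-congʳ-mod (e * t) (*-congʳ-mod a ce≡1) ⟨
      c * e * a + e * t   ≡⟨ factor-e c e a t ⟩
      e * (c * a + t)     ≈⟨ *-congˡ-mod e ca+t≡0 ⟩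
      e * 0               ≡⟨ ℕₚ.*-zeroʳ e ⟩
      0                   ∎
      where
      factor-e : ∀ c e a t → c * e * a + e * t ≡ e * (c * a + t)
      factor-e = ℕ-Solver.solve-∀
    [m∸1]et+et≡0 : (m ∸ 1) * (e * t) + e * t ≡ 0 [mod m ]
    [m∸1]et+et≡0 = subst (_≡ 0 [mod m ]) (ℕₚ.+-comm (e * t) _) (x+[m∸1]*x≡0-mod (e * t))

toℕ-mod : ∀ x m .{{_ : NonZero m}} → toℕ (x mod m) ≡ x [mod m ]
toℕ-mod x m = mod-sym (subst (_≡ toℕ (x mod m) [mod m ]) (sym (DivMod.property (x divMod m)))
                         (x+n*m≡x-mod (toℕ (x mod m)) (DivMod.quotient (x divMod m))))

≡-mod-resp-⇔ : ∀ {m a a' b b'} → a ≡ a' [mod m ] → b ≡ b' [mod m ] →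
  (a ≡ b [mod m ]) ⇔ (a' ≡ b' [mod m ])
≡-mod-resp-⇔ a≡a' b≡b' = mk⇔ (λ a≡b → mod-trans (mod-sym a≡a') (mod-trans a≡b b≡b'))
                              (λ a'≡b' → mod-trans a≡a' (mod-trans a'≡b' (mod-sym b≡b')))

unit-rescaling : ∀ {m s P w w' β X} → s ≡ P * w [mod m ] → w * w' ≡ 1 [mod m ] →
  (s * β + X ≡ 0 [mod m ]) ⇔ (w' * X + P * β ≡ 0 [mod m ])
unit-rescaling {m} {s} {P} {w} {w'} {β} {X} s≡Pw ww'≡1 =
  ≡-mod-resp-⇔ rescaled mod-refl ⇔-∘ *-unit-≡0-mod {u = w} {w'} ww'≡1
  where
  open ≡-mod-Reasoning m
  rescaled : w' * (s * β + X) ≡ w' * X + P * β [mod m ]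
  rescaled = begin
    w' * (s * β + X)            ≡⟨ ℕ-Solver.solve (w' ∷ s ∷ β ∷ X ∷ []) ⟩
    w' * s * β + w' * X         ≈⟨ +-congʳ-mod (w' * X) (*-congʳ-mod β (*-congˡ-mod w' s≡Pw)) ⟩
    w' * (P * w) * β + w' * X   ≡⟨ ℕ-Solver.solve (w' ∷ P ∷ w ∷ β ∷ X ∷ []) ⟩
    w' * X + P * β * (w * w')   ≈⟨ +-congˡ-mod (w' * X) (*-congˡ-mod (P * β) ww'≡1) ⟩
    w' * X + P * β * 1          ≡⟨ cong (_+_ (w' * X)) (ℕₚ.*-identityʳ (P * β)) ⟩
    w' * X + P * β              ∎

-- Units modulo prime powers

record PrimePowerTimesUnit (p k s : ℕ) : Set where
  field
    exponent      : Fin (suc k)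
    unit unit⁻¹   : ℕ
    factorisation : s ≡ p ^ toℕ exponent * unit [mod p ^ k ]
    unit-inverse  : unit * unit⁻¹ ≡ 1 [mod p ^ k ]

module _ {p : ℕ} (p-prime : Prime p) where

  private instance
    p≢0 : NonZero p
    p≢0 = prime⇒nonZero p-prime

  coprime-prime-power : ∀ {s} → ¬ p ∣ s → ∀ k → Coprime s (p ^ k)
  coprime-prime-power p∤s zero    (d∣s , d∣1)   = ∣.∣1⇒≡1 d∣1
  coprime-prime-power {s} p∤s (suc k) (d∣s , d∣p*p^k) = coprime-prime-power p∤s k
    (d∣s , Coprime.coprime-factors coprime-s-p (∣.∣-trans d∣s (∣.m∣m*n (p ^ k)) , d∣p*p^k))
    where
    coprime-s-p : Coprime s p
    coprime-s-p (e∣s , e∣p) with prime⇒irreducible p-prime e∣p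
    ... | inj₁ e≡1 = e≡1
    ... | inj₂ refl = ⊥-elim (p∤s e∣s)

  -- Bézout gives either s x = 1 + y q or 1 + s x = y q; in the second case the inverse
  -- is (q ∸ 1) x ≡ -x.
  inverse-mod-prime-power : ∀ {s} → ¬ p ∣ s → ∀ k → ∃[ u ] s * u ≡ 1 [mod p ^ k ]
  inverse-mod-prime-power {s} p∤s k with Coprime.coprime-Bézout (coprime-prime-power p∤s k)
  ... | Bézout.+- x y 1+yq≡xs = x , (begin
    s * x       ≡⟨ trans (ℕₚ.*-comm s x) (sym 1+yq≡xs) ⟩
    1 + y * q   ≈⟨ x+n*m≡x-mod 1 y ⟩
    1           ∎)
    where
    q : ℕ
    q = p ^ k
    open ≡-mod-Reasoning q
  ... | Bézout.-+ x y 1+xs≡yq = x * (q ∸ 1) , Equivalence.to (+≡0-mod-unique 1+sx≡0) s[x[q∸1]]+sx≡0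
    where
    q : ℕ
    q = p ^ k
    instance
      q≢0 : NonZero q
      q≢0 = ℕₚ.m^n≢0 p k
    1+sx≡0 : 1 + s * x ≡ 0 [mod q ]
    1+sx≡0 = subst (_≡ 0 [mod q ]) (trans (sym 1+xs≡yq) (cong (_+_ 1) (ℕₚ.*-comm x s))) (n*m≡0-mod y)
    s[x[q∸1]]+sx≡0 : s * (x * (q ∸ 1)) + s * x ≡ 0 [mod q ]
    s[x[q∸1]]+sx≡0 = subst (_≡ 0 [mod q ]) (sym (regroup s x (q ∸ 1))) (x+[m∸1]*x≡0-mod {q} (s * x))
      where
      regroup : ∀ s x r → s * (x * r) + s * x ≡ s * x + r * (s * x)
      regroup = ℕ-Solver.solve-∀

  prime-power-factorisation : ∀ k s → 0 < s → s < p ^ k →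
    Σ[ j ∈ Fin (suc k) ] ∃[ s' ] (s ≡ p ^ toℕ j * s') × ¬ p ∣ s'
  prime-power-factorisation zero s 0<s s<1 = ⊥-elim (ℕₚ.<⇒≱ 0<s (ℕₚ.≤-pred s<1))
  prime-power-factorisation (suc k) s 0<s s<p^[1+k] with p ∣? s
  ... | no p∤s = fzero , s , sym (ℕₚ.*-identityˡ s) , p∤s
  ... | yes (divides w refl) with prime-power-factorisation k w 0<w w<p^k
    where
    0<w : 0 < w
    0<w = ℕ.>-nonZero⁻¹ w {{ℕₚ.m*n≢0⇒m≢0 w {{ℕ.>-nonZero 0<s}}}}
    w<p^k : w < p ^ k
    w<p^k = ℕₚ.*-cancelʳ-< p w (p ^ k) (subst (w * p <_) (ℕₚ.*-comm p (p ^ k)) s<p^[1+k])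
  ... | j , s' , refl , p∤s' = fsuc j , s' , reassociate (p ^ toℕ j) s' p , p∤s'
    where
    reassociate : ∀ a s p → a * s * p ≡ p * a * s
    reassociate = ℕ-Solver.solve-∀

  unit-times-prime-power : ∀ k s → s < p ^ k → PrimePowerTimesUnit p k s
  unit-times-prime-power k zero _ = record
    { exponent = Fin.fromℕ k ; unit = 1 ; unit⁻¹ = 1
    ; factorisation = mod-sym (subst (_≡ 0 [mod p ^ k ]) p^k≡p^k*1 (n*m≡0-mod 1))
    ; unit-inverse = mod-refl
    }
    where
    p^k≡p^k*1 : 1 * p ^ k ≡ p ^ toℕ (Fin.fromℕ k) * 1
    p^k≡p^k*1 = trans (ℕₚ.*-comm 1 (p ^ k)) (cong (λ i → p ^ i * 1) (sym (Finₚ.toℕ-fromℕ k)))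
  unit-times-prime-power k s@(suc _) s<p^k =
    let (j , s' , s≡p^j*s' , p∤s') = prime-power-factorisation k s z<s s<p^k
        (u , s'u≡1) = inverse-mod-prime-power p∤s' k
    in record { exponent = j ; unit = s' ; unit⁻¹ = u ; factorisation = mod-reflexive s≡p^j*s' ; unit-inverse = s'u≡1 }

-- Finite sums

sumFin≡sum : ∀ n (f : Fin n → ℕ) → sumFin n f ≡ sum f
sumFin≡sum zero    f = refl
sumFin≡sum (suc n) f = cong (_+_ (f fzero)) (sumFin≡sum n (f ∘ fsuc))

sumFin-cong : ∀ n {f g : Fin n → ℕ} → (∀ i → f i ≡ g i) → sumFin n f ≡ sumFin n g
sumFin-cong n {f} {g} f≗g = trans (sumFin≡sum n f) (trans (sum-cong-≗ f≗g) (sym (sumFin≡sum n g)))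

sum-cong-mod : ∀ {m n} {f g : Fin n → ℕ} → (∀ i → f i ≡ g i [mod m ]) → sum f ≡ sum g [mod m ]
sum-cong-mod {n = zero}  f≡g = mod-refl
sum-cong-mod {n = suc n} f≡g = +-cong-mod (f≡g fzero) (sum-cong-mod (f≡g ∘ fsuc))

sum-↑ : ∀ m n (f : Fin (m + n) → ℕ) → sum f ≡ sum (λ i → f (i ↑ˡ n)) + sum (λ j → f (m ↑ʳ j))
sum-↑ zero    n f = refl
sum-↑ (suc m) n f = trans (cong (_+_ (f fzero)) (sum-↑ m n (f ∘ fsuc))) (sym (ℕₚ.+-assoc (f fzero) _ _))

sum-combine : ∀ m n (f : Fin (m * n) → ℕ) → sum f ≡ sum {m} (λ i → sum {n} (λ j → f (combine i j)))
sum-combine zero    n f = refl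
sum-combine (suc m) n f = begin
  sum f                                                    ≡⟨ sum-↑ n (m * n) f ⟩
  sum (λ j → f (j ↑ˡ (m * n))) + sum (λ k → f (n ↑ʳ k))
    ≡⟨ cong (_+_ (sum (λ j → f (j ↑ˡ (m * n))))) (sum-combine m n (λ k → f (n ↑ʳ k))) ⟩
  sum {suc m} (λ i → sum {n} (λ j → f (combine i j)))      ∎
  where open ≡-Reasoning

δ : ∀ {n} → Fin n → Fin n → ℕ
δ i j = if does (i Fin.≟ j) then 1 else 0

δ-diag : ∀ {n} (j : Fin n) → δ j j ≡ 1
δ-diag j = cong (if_then 1 else 0) (dec-true (j Fin.≟ j) refl)

δ-≢ : ∀ {n} {i j : Fin n} → i ≢ j → δ i j ≡ 0
δ-≢ {i = i} {j} i≢j = cong (if_then 1 else 0) (dec-false (i Fin.≟ j) i≢j)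

sum-δ : ∀ {n} (j : Fin n) (f : Fin n → ℕ) → sum (λ i → δ i j * f i) ≡ f j
sum-δ {suc n} j f = begin
  sum (λ i → δ i j * f i)                                     ≡⟨ sum-remove {i = j} (λ i → δ i j * f i) ⟩
  δ j j * f j + sum (λ i → δ (punchIn j i) j * f (punchIn j i))
    ≡⟨ cong₂ _+_ (cong (_* f j) (δ-diag j)) (sum-cong-≗ off-diagonal) ⟩
  1 * f j + sum {n} (λ _ → 0)
    ≡⟨ cong₂ _+_ (ℕₚ.*-identityˡ (f j)) (sum-replicate-zero n) ⟩
  f j + 0                                                     ≡⟨ ℕₚ.+-identityʳ (f j) ⟩
  f j                                                         ∎
  where
  open ≡-Reasoning
  off-diagonal : ∀ i → δ (punchIn j i) j * f (punchIn j i) ≡ 0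
  off-diagonal i = cong (_* f (punchIn j i)) (δ-≢ (Finₚ.punchInᵢ≢i j i))

unflatten : ∀ {A : Set} {C J r} → (Fin C → Fin J → Fin r → A) → Fin (C * J * r) → A
unflatten {J = J} {r} f I = uncurry (λ cj i → uncurry (λ c j → f c j i) (Fin.remQuot J cj)) (Fin.remQuot r I)

unflatten-combine : ∀ {A : Set} {C J r} (f : Fin C → Fin J → Fin r → A) c j i →
  unflatten f (combine (combine c j) i) ≡ f c j i
unflatten-combine {C = C} {J} {r} f c j i =
  trans (cong (uncurry (λ cj i → uncurry (λ c j → f c j i) (Fin.remQuot J cj)))
              (Finₚ.remQuot-combine {C * J} {r} (combine c j) i))
        (cong (uncurry (λ c j → f c j i)) (Finₚ.remQuot-combine {C} {J} c j))

unflatten-cong : ∀ {A : Set} {C J r} {f g : Fin C → Fin J → Fin r → A} →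
  (∀ c j i → f c j i ≡ g c j i) → ∀ I → unflatten f I ≡ unflatten g I
unflatten-cong {J = J} {r} f≗g I =
  uncurry (λ cj i → uncurry (λ c j → f≗g c j i) (Fin.remQuot J cj)) (Fin.remQuot r I)

sum-δ-δ : ∀ {C J r} (c₀ : Fin C) (j₀ : Fin C → Fin J) (X : Fin C → Fin J → Fin r → ℕ) →
  sum {C * J * r} (unflatten (λ c j i → δ c c₀ * (δ j (j₀ c) * X c j i))) ≡ sum (X c₀ (j₀ c₀))
sum-δ-δ {C} {J} {r} c₀ j₀ X = begin
  sum (unflatten F)                                              ≡⟨ sum-combine (C * J) r _ ⟩
  sum {C * J} (λ cj → sum {r} (λ i → unflatten F (combine cj i))) ≡⟨ sum-combine C J _ ⟩
  sum {C} (λ c → sum {J} (λ j → sum {r} (λ i → unflatten F (combine (combine c j) i))))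
    ≡⟨ sum-cong-≗ {C} (λ c → sum-cong-≗ {J} (λ j → sum-cong-≗ {r} (unflatten-combine F c j))) ⟩
  sum {C} (λ c → sum {J} (λ j → sum {r} (F c j)))
    ≡⟨ sum-cong-≗ {C} (λ c → sum-cong-≗ {J} (λ j → pull-out c j)) ⟩
  sum {C} (λ c → sum {J} (λ j → δ c c₀ * (δ j (j₀ c) * sum (X c j))))
    ≡⟨ sum-cong-≗ {C} (λ c → *-distribˡ-sum (δ c c₀) (λ j → δ j (j₀ c) * sum (X c j))) ⟨
  sum {C} (λ c → δ c c₀ * sum {J} (λ j → δ j (j₀ c) * sum (X c j)))
    ≡⟨ sum-δ c₀ (λ c → sum {J} (λ j → δ j (j₀ c) * sum (X c j))) ⟩
  sum {J} (λ j → δ j (j₀ c₀) * sum (X c₀ j))                     ≡⟨ sum-δ (j₀ c₀) (λ j → sum (X c₀ j)) ⟩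
  sum (X c₀ (j₀ c₀))                                             ∎
  where
  open ≡-Reasoning
  F : Fin C → Fin J → Fin r → ℕ
  F c j i = δ c c₀ * (δ j (j₀ c) * X c j i)
  pull-out : ∀ c j → sum (F c j) ≡ δ c c₀ * (δ j (j₀ c) * sum (X c j))
  pull-out c j = begin
    sum (F c j)                                  ≡⟨ *-distribˡ-sum (δ c c₀) (λ i → δ j (j₀ c) * X c j i) ⟨
    δ c c₀ * sum (λ i → δ j (j₀ c) * X c j i)    ≡⟨ cong (δ c c₀ *_) (*-distribˡ-sum (δ j (j₀ c)) (X c j)) ⟨
    δ c c₀ * (δ j (j₀ c) * sum (X c j))          ∎

-- Linear dependence over ℤ/pℤ

funToFin-cong : ∀ {m n} {f g : Fin m → Fin n} → (∀ i → f i ≡ g i) → funToFin f ≡ funToFin g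
funToFin-cong {zero}  f≗g = refl
funToFin-cong {suc m} f≗g = cong₂ combine (f≗g fzero) (funToFin-cong (f≗g ∘ fsuc))

¬¬-Π-Fin : ∀ {n} {P : Fin n → Set} → (∀ i → ¬ ¬ P i) → ¬ ¬ (∀ i → P i)
¬¬-Π-Fin {zero}  ¬¬P ¬∀P = ¬∀P λ ()
¬¬-Π-Fin {suc n} ¬¬P ¬∀P = ¬¬P fzero λ P0 → ¬¬-Π-Fin (¬¬P ∘ fsuc) λ P-suc →
  ¬∀P λ { fzero → P0 ; (fsuc i) → P-suc i }

Dependent : (p t : ℕ) {Col : Set} → (Fin t → Col → ℕ) → Set
Dependent p t v = Σ[ c ∈ (Fin t → ℕ) ] (∃[ j ] ¬ p ∣ c j) × (∀ x → p ∣ sumFin t (λ j → c j * v j x))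

InSpan : (p : ℕ) {Col : Set} {m : ℕ} → (Fin m → Col → ℕ) → (Col → ℕ) → Set
InSpan p {m = m} g v = Σ[ d ∈ (Fin m → ℕ) ] ∀ x → v x ≡ sum {m} (λ i → d i * g i x) [mod p ]

module _ {p : ℕ} (1<p : 1 < p) where

  private instance
    p≢0 : NonZero p
    p≢0 = ℕ.>-nonZero (ℕₚ.<-trans z<s 1<p)

  distinct-solutions⇒dependent : ∀ {N} {Col : Set} (v : Fin N → Col → ℕ) (x y : Fin N → Fin p) →
    (∃[ j ] x j ≢ y j) →
    (∀ i → sum (λ j → toℕ (x j) * v j i) ≡ sum (λ j → toℕ (y j) * v j i) [mod p ]) →
    Dependent p N v
  distinct-solutions⇒dependent {N} {Col} v x y (j , xj≢yj) x≡y = c , (j , p∤cj) , relation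
    where
    c : Fin N → ℕ
    c j = toℕ (x j) + (p ∸ 1) * toℕ (y j)
    p∤cj : ¬ p ∣ c j
    p∤cj p∣cj = xj≢yj (Finₚ.toℕ-injective (≡-mod⇒≡ (Finₚ.toℕ<n (x j)) (Finₚ.toℕ<n (y j))
      (Equivalence.to (+≡0-mod-unique (x+[m∸1]*x≡0-mod (toℕ (y j)))) (∣⇒≡0-mod p∣cj))))
    Σx Σy : Col → ℕ
    Σx i = sum (λ j → toℕ (x j) * v j i)
    Σy i = sum (λ j → toℕ (y j) * v j i)
    expand : ∀ i → sumFin N (λ j → c j * v j i) ≡ Σx i + (p ∸ 1) * Σy i
    expand i = begin
      sumFin N (λ j → c j * v j i)                                   ≡⟨ sumFin≡sum N _ ⟩
      sum (λ j → c j * v j i)                                        ≡⟨ sum-cong-≗ distrib ⟩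
      sum (λ j → toℕ (x j) * v j i + (p ∸ 1) * (toℕ (y j) * v j i))
        ≡⟨ ∑-distrib-+ (λ j → toℕ (x j) * v j i) (λ j → (p ∸ 1) * (toℕ (y j) * v j i)) ⟩
      Σx i + sum (λ j → (p ∸ 1) * (toℕ (y j) * v j i))
        ≡⟨ cong (_+_ (Σx i)) (*-distribˡ-sum (p ∸ 1) (λ j → toℕ (y j) * v j i)) ⟨
      Σx i + (p ∸ 1) * Σy i                                          ∎
      where
      open ≡-Reasoning
      distrib : ∀ j → c j * v j i ≡ toℕ (x j) * v j i + (p ∸ 1) * (toℕ (y j) * v j i)
      distrib j = trans (ℕₚ.*-distribʳ-+ (v j i) (toℕ (x j)) _)
                        (cong (_+_ (toℕ (x j) * v j i)) (ℕₚ.*-assoc (p ∸ 1) (toℕ (y j)) (v j i)))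
    relation : ∀ i → p ∣ sumFin N (λ j → c j * v j i)
    relation i = ≡0-mod⇒∣ (subst (_≡ 0 [mod p ]) (sym (expand i))
      (mod-trans (+-congʳ-mod ((p ∸ 1) * Σy i) (x≡y i)) (x+[m∸1]*x≡0-mod (Σy i))))

  -- Pigeonhole over the p ^ N coefficient vectors in {0, …, p-1}^N, sorted by the
  -- residues mod p of the m resulting combinations.
  fewer-coordinates⇒dependent : ∀ {N m} → m < N → (v : Fin N → Fin m → ℕ) → Dependent p N v
  fewer-coordinates⇒dependent {N} {m} m<N v = from-collision (Finₚ.pigeonhole (ℕₚ.^-monoʳ-< p 1<p m<N) residues)
    where
    combination : Fin (p ^ N) → Fin m → ℕ
    combination a i = sum (λ j → toℕ (finToFun a j) * v j i)
    residues : Fin (p ^ N) → Fin (p ^ m)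
    residues a = funToFin (λ i → combination a i mod p)
    from-collision : ∃₂ (λ a b → a Fin.< b × residues a ≡ residues b) → Dependent p N v
    from-collision (a , b , a<b , same) =
      distinct-solutions⇒dependent v (finToFun a) (finToFun b) a≉b same-residues
      where
      a≉b : ∃[ j ] finToFun a j ≢ finToFun b j
      a≉b = Finₚ.¬∀⟶∃¬ N _ (λ j → finToFun a j Fin.≟ finToFun b j) λ a≗b →
        Finₚ.<-irrefl (trans (sym (Finₚ.funToFin-finToFin {N} {p} a))
                             (trans (funToFin-cong a≗b) (Finₚ.funToFin-finToFin {N} {p} b))) a<b
      same-residues : ∀ i → combination a i ≡ combination b i [mod p ]
      same-residues i = begin
        combination a i              ≈⟨ toℕ-mod (combination a i) p ⟨
        toℕ (combination a i mod p)  ≡⟨ cong toℕ residue-a≡residue-b ⟩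
        toℕ (combination b i mod p)  ≈⟨ toℕ-mod (combination b i) p ⟩
        combination b i              ∎
        where
        open ≡-mod-Reasoning p
        residue-a≡residue-b : combination a i mod p ≡ combination b i mod p
        residue-a≡residue-b = trans (sym (Finₚ.finToFun-funToFin _ i))
          (trans (cong (λ r → finToFun r i) same) (Finₚ.finToFun-funToFin _ i))

  spanned-by-fewer⇒dependent : ∀ {N m} {Col : Set} → m < N → (g : Fin m → Col → ℕ) (v : Fin N → Col → ℕ) →
    (∀ j → InSpan p g (v j)) → Dependent p N v
  spanned-by-fewer⇒dependent {N} {m} m<N g v spans = c , nontrivial , relation
    where
    D : Fin N → Fin m → ℕ
    D j = proj₁ (spans j)
    c : Fin N → ℕ
    c = proj₁ (fewer-coordinates⇒dependent m<N D)
    nontrivial : ∃[ j ] ¬ p ∣ c j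
    nontrivial = proj₁ (proj₂ (fewer-coordinates⇒dependent m<N D))
    c-kills-D : ∀ i → p ∣ sumFin N (λ j → c j * D j i)
    c-kills-D = proj₂ (proj₂ (fewer-coordinates⇒dependent m<N D))
    reorder : ∀ x → sum (λ j → c j * sum (λ i → D j i * g i x)) ≡ sum (λ i → sum (λ j → c j * D j i) * g i x)
    reorder x = begin
      sum (λ j → c j * sum (λ i → D j i * g i x))
        ≡⟨ sum-cong-≗ (λ j → *-distribˡ-sum (c j) (λ i → D j i * g i x)) ⟩
      sum (λ j → sum (λ i → c j * (D j i * g i x)))
        ≡⟨ sum-cong-≗ (λ j → sum-cong-≗ (λ i → sym (ℕₚ.*-assoc (c j) (D j i) (g i x)))) ⟩
      sum (λ j → sum (λ i → c j * D j i * g i x))     ≡⟨ ∑-comm (λ j i → c j * D j i * g i x) ⟩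
      sum (λ i → sum (λ j → c j * D j i * g i x))
        ≡⟨ sum-cong-≗ (λ i → *-distribʳ-sum (g i x) (λ j → c j * D j i)) ⟨
      sum (λ i → sum (λ j → c j * D j i) * g i x)     ∎
      where open ≡-Reasoning
    relation : ∀ x → p ∣ sumFin N (λ j → c j * v j x)
    relation x = ≡0-mod⇒∣ (begin
      sumFin N (λ j → c j * v j x)                   ≡⟨ sumFin≡sum N _ ⟩
      sum (λ j → c j * v j x)                        ≈⟨ sum-cong-mod (λ j → *-congˡ-mod (c j) (proj₂ (spans j) x)) ⟩
      sum (λ j → c j * sum (λ i → D j i * g i x))    ≡⟨ reorder x ⟩
      sum (λ i → sum (λ j → c j * D j i) * g i x)    ≈⟨ sum-cong-mod (λ i → *-congʳ-mod (g i x) (coefficient≡0 i)) ⟩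
      sum {m} (λ i → 0 * g i x)                      ≡⟨ sum-replicate-zero m ⟩
      0                                              ∎)
      where
      open ≡-mod-Reasoning p
      coefficient≡0 : ∀ i → sum (λ j → c j * D j i) ≡ 0 [mod p ]
      coefficient≡0 i = ∣⇒≡0-mod (subst (p ∣_) (sumFin≡sum N _) (c-kills-D i))

-- Rank

module _ {p : ℕ} {Row Col : Set} (M : Matrix Row Col) where

  independent⇒¬dependent : ∀ {t rs} → Independent p M t rs → ¬ Dependent p t (M ∘ rs)
  independent⇒¬dependent independent (c , (j , p∤cj) , relation) = p∤cj (independent c relation j)

  ¬independent⇒¬¬dependent : ∀ {t rs} → ¬ Independent p M t rs → ¬ ¬ Dependent p t (M ∘ rs)
  ¬independent⇒¬¬dependent ¬independent ¬dependent = ¬independent λ c relation i →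
    decidable-stable (p ∣? c i) (λ p∤ci → ¬dependent (c , (i , p∤ci) , relation))

  independent-tail : ∀ {t rs} → Independent p M (suc t) rs → Independent p M t (rs ∘ fsuc)
  independent-tail independent c relation i = independent (0 Vector.∷ c) relation (fsuc i)

  independent-≤ : ∀ {t s rs} → t ≤ s → Independent p M s rs → ∃ (Independent p M t)
  independent-≤ {t} {rs = rs} t≤s = go {rs = rs} (ℕₚ.≤⇒≤′ t≤s)
    where
    go : ∀ {s rs} → t ℕ.≤′ s → Independent p M s rs → ∃ (Independent p M t)
    go {rs = rs} ℕ.≤′-refl         independent = rs , independent
    go {rs = rs} (ℕ.≤′-step t≤′s) independent = go t≤′s (independent-tail {rs = rs} independent)

  independent⇒≤rank : ∀ {r t rs} → HasRank p M r → Independent p M t rs → t ≤ r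
  independent⇒≤rank {r} {t} {rs} (_ , maximal) independent = decidable-stable (t ℕₚ.≤? r) λ t≰r →
    uncurry maximal (independent-≤ {rs = rs} (ℕₚ.≰⇒> t≰r) independent)

  ¬¬spanned⇒≤ : 1 < p → ∀ {B t rs} (g : Fin B → Col → ℕ) → (∀ r → ¬ ¬ InSpan p g (M r)) →
    Independent p M t rs → t ≤ B
  ¬¬spanned⇒≤ 1<p {B} {t} {rs₀} g ¬¬spanned independent = decidable-stable (t ℕₚ.≤? B) λ t≰B →
    let (rs , independent') = independent-≤ {rs = rs₀} (ℕₚ.≰⇒> t≰B) independent in
    ¬¬-Π-Fin (¬¬spanned ∘ rs) λ spanned →
      independent⇒¬dependent {rs = rs} independent' (spanned-by-fewer⇒dependent 1<p (ℕₚ.n<1+n B) g (M ∘ rs) spanned)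

module _ {p : ℕ} (p-prime : Prime p) {Row Col : Set} (M : Matrix Row Col) where

  private instance
    p≢0 : NonZero p
    p≢0 = prime⇒nonZero p-prime

  dependent-extension⇒spanned : ∀ {r S ρ} → Independent p M r S →
    Dependent p (suc r) (M ∘ (ρ Vector.∷ S)) → InSpan p (M ∘ S) (M ρ)
  dependent-extension⇒spanned {r} {S} {ρ} independent (c , (j , p∤cj) , relation) = by-cases (p ∣? c fzero)
    where
    T : Col → ℕ
    T x = sum (λ i → c (fsuc i) * M (S i) x)
    c₀A+T≡0 : ∀ x → c fzero * M ρ x + T x ≡ 0 [mod p ]
    c₀A+T≡0 x = ∣⇒≡0-mod (subst (λ t → p ∣ c fzero * M ρ x + t) (sumFin≡sum r _) (relation x))
    by-cases : Dec (p ∣ c fzero) → InSpan p (M ∘ S) (M ρ)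
    by-cases (yes p∣c₀) = ⊥-elim (p∤cj (all-divisible j))
      where
      all-divisible : ∀ j → p ∣ c j
      all-divisible fzero    = p∣c₀
      all-divisible (fsuc i) = independent (c ∘ fsuc) (λ x → ∣.∣m+n∣m⇒∣n (relation x) (∣.∣m⇒∣m*n (M ρ x) p∣c₀)) i
    by-cases (no p∤c₀) = (λ i → (p ∸ 1) * e * c (fsuc i)) , expresses
      where
      e : ℕ
      e = proj₁ (inverse-mod-prime-power p-prime p∤c₀ 1)
      c₀e≡1 : c fzero * e ≡ 1 [mod p ]
      c₀e≡1 = subst (c fzero * e ≡ 1 [mod_]) (ℕₚ.*-identityʳ p) (proj₂ (inverse-mod-prime-power p-prime p∤c₀ 1))
      expresses : ∀ x → M ρ x ≡ sum (λ i → (p ∸ 1) * e * c (fsuc i) * M (S i) x) [mod p ]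
      expresses x = begin
        M ρ x
          ≈⟨ unit-coefficient-mod {c = c fzero} {e} {M ρ x} {T x} c₀e≡1 (c₀A+T≡0 x) ⟩
        (p ∸ 1) * (e * T x)                            ≡⟨ ℕₚ.*-assoc (p ∸ 1) e (T x) ⟨
        (p ∸ 1) * e * T x
          ≡⟨ *-distribˡ-sum ((p ∸ 1) * e) (λ i → c (fsuc i) * M (S i) x) ⟩
        sum (λ i → (p ∸ 1) * e * (c (fsuc i) * M (S i) x))
          ≡⟨ sum-cong-≗ (λ i → sym (ℕₚ.*-assoc ((p ∸ 1) * e) (c (fsuc i)) (M (S i) x))) ⟩
        sum (λ i → (p ∸ 1) * e * c (fsuc i) * M (S i) x)   ∎
        where open ≡-mod-Reasoning p

  maximal-independent⇒spanning : ∀ {r S} → Independent p M r S → (∀ rs → ¬ Independent p M (suc r) rs) →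
    ∀ ρ → ¬ ¬ InSpan p (M ∘ S) (M ρ)
  maximal-independent⇒spanning {r} {S} independent maximal ρ ¬spanned =
    ¬independent⇒¬¬dependent M {rs = ρ Vector.∷ S} (maximal (ρ Vector.∷ S))
      (¬spanned ∘ dependent-extension⇒spanned {S = S} independent)

module _ {p : ℕ} (p-prime : Prime p) {Row Row' Col Col' : Set} (M : Matrix Row Col) (M' : Matrix Row' Col') where

  -- The rows of M' are spanned by the C * J * r vectors  y ↦ [τ c y ≡ j] * M (S i) (ψ c y),
  -- S a maximal independent family of rows of M.
  rank-≤-piecewise : ∀ {C J} (τ : Fin C → Col' → Fin J) (ψ : Fin C → Col' → Col)
    (sector : Row' → Fin C) (φ : Row' → Fin J → Row) →
    (∀ r' y → M' r' y ≡ M (φ r' (τ (sector r') y)) (ψ (sector r') y)) →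
    ∀ {r r'} → HasRank p M r → HasRank p M' r' → r' ≤ C * J * r
  rank-≤-piecewise {C} {J} τ ψ sector φ M'≡M {r} ((S , independent) , maximal) ((_ , independent') , _) =
    ¬¬spanned⇒≤ M' (ℕ.nonTrivial⇒n>1 p {{prime⇒nonTrivial p-prime}}) G spanned independent'
    where
    G : Fin (C * J * r) → Col' → ℕ
    G I y = unflatten (λ c j i → δ j (τ c y) * M (S i) (ψ c y)) I
    represent : ∀ r' → (∀ j → InSpan p (M ∘ S) (M (φ r' j))) → InSpan p G (M' r')
    represent r' spans = D , expresses
      where
      c₀ : Fin C
      c₀ = sector r'
      d : Fin J → Fin r → ℕ
      d j = proj₁ (spans j)
      D : Fin (C * J * r) → ℕ
      D = unflatten (λ c j i → δ c c₀ * d j i)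
      expresses : ∀ y → M' r' y ≡ sum (λ I → D I * G I y) [mod p ]
      expresses y = begin
        M' r' y                                              ≡⟨ M'≡M r' y ⟩
        M (φ r' (τ c₀ y)) (ψ c₀ y)                           ≈⟨ proj₂ (spans (τ c₀ y)) (ψ c₀ y) ⟩
        sum (λ i → d (τ c₀ y) i * M (S i) (ψ c₀ y))          ≡⟨ sum-δ-δ c₀ (λ c → τ c y) X ⟨
        sum (unflatten (λ c j i → δ c c₀ * (δ j (τ c y) * X c j i)))
          ≡⟨ sum-cong-≗ {C * J * r} (unflatten-cong reorder) ⟩
        sum (λ I → D I * G I y)                              ∎
        where
        open ≡-mod-Reasoning p
        X : Fin C → Fin J → Fin r → ℕ
        X c j i = d j i * M (S i) (ψ c y)
        reorder : ∀ c j i → δ c c₀ * (δ j (τ c y) * X c j i) ≡ δ c c₀ * d j i * (δ j (τ c y) * M (S i) (ψ c y))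
        reorder c j i = rearrange (δ c c₀) (δ j (τ c y)) (d j i) (M (S i) (ψ c y))
          where
          rearrange : ∀ a b e m → a * (b * (e * m)) ≡ a * e * (b * m)
          rearrange = ℕ-Solver.solve-∀
    spanned : ∀ r' → ¬ ¬ InSpan p G (M' r')
    spanned r' = ¬¬-map (represent r') (¬¬-Π-Fin (maximal-independent⇒spanning p-prime M independent maximal ∘ φ r'))

module _ {p : ℕ} {Row Row' Col Col' : Set} (M : Matrix Row Col) (M' : Matrix Row' Col') where

  rank-≤-embedding : (f : Row → Row') (g : Col → Col') → (∀ r x → M' (f r) (g x) ≡ M r x) →
    ∀ {r r'} → HasRank p M r → HasRank p M' r' → r ≤ r'
  rank-≤-embedding f g M'≡M {r} ((S , independent) , _) rank' =
    independent⇒≤rank M' {rs = f ∘ S} rank' λ c relation →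
      independent c λ x → subst (p ∣_) (sumFin-cong r (λ i → cong (c i *_) (M'≡M (S i) x))) (relation (g x))

-- Hyperplanes

indicT-cong : ∀ {q m m' t t'} {b : ProjPt q m} {b' : ProjPt q m'} {x : Vecʳ q m} {x' : Vecʳ q m'} →
  (dot q m x (vec b) ≡ t [mod q ]) ⇔ (dot q m' x' (vec b') ≡ t' [mod q ]) →
  indicT q m t b x ≡ indicT q m' t' b' x'
indicT-cong {q} {m} {m'} {t} {t'} {b} {b'} {x} {x'} equivalent = cong (if_then 1 else 0)
  (does-⇔ (⇔-sym EqR⇔≡-mod ⇔-∘ (equivalent ⇔-∘ EqR⇔≡-mod)) (q ∣? ∣ dot q m x (vec b) - t ∣) (q ∣? ∣ dot q m' x' (vec b') - t' ∣))

dot-cong : ∀ {q m} {x x' b b' : Vecʳ q m} → (∀ i → x i ≡ x' i) → (∀ i → b i ≡ b' i) → dot q m x b ≡ dot q m x' b'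
dot-cong {m = m} x≗x' b≗b' = sumFin-cong m (λ i → cong₂ (λ u v → toℕ u * toℕ v) (x≗x' i) (b≗b' i))

dot-removeAt : ∀ {q m} (x b : Vecʳ q (suc m)) i →
  dot q (suc m) x b ≡ toℕ (x i) * toℕ (b i) + dot q m (removeAt x i) (removeAt b i)
dot-removeAt {q} {m} x b i = begin
  dot q (suc m) x b                                    ≡⟨ sumFin≡sum (suc m) (λ j → toℕ (x j) * toℕ (b j)) ⟩
  sum (λ j → toℕ (x j) * toℕ (b j))                    ≡⟨ sum-remove {i = i} (λ j → toℕ (x j) * toℕ (b j)) ⟩
  toℕ (x i) * toℕ (b i) + sum (λ j → toℕ (removeAt x i j) * toℕ (removeAt b i j))
    ≡⟨ cong (_+_ (toℕ (x i) * toℕ (b i))) (sumFin≡sum m (λ j → toℕ (removeAt x i j) * toℕ (removeAt b i j))) ⟨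
  toℕ (x i) * toℕ (b i) + dot q m (removeAt x i) (removeAt b i) ∎
  where open ≡-Reasoning

dot-insertAt : ∀ {q m} (x b : Vecʳ q m) i u v →
  dot q (suc m) (insertAt x i u) (insertAt b i v) ≡ toℕ u * toℕ v + dot q m x b
dot-insertAt x b i u v = trans (dot-removeAt (insertAt x i u) (insertAt b i v) i)
  (cong₂ _+_ (cong₂ (λ u v → toℕ u * toℕ v) (Vectorₚ.insertAt-lookup x i u) (Vectorₚ.insertAt-lookup b i v))
             (dot-cong (Vectorₚ.removeAt-insertAt x i u) (Vectorₚ.removeAt-insertAt b i v)))

insertAt-last-inject₁ : ∀ {A : Set} {n} (xs : Vector.Vector A n) v (i : Fin n) → insertAt xs (Fin.fromℕ n) v (Fin.inject₁ i) ≡ xs i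
insertAt-last-inject₁ {n = suc n} xs v fzero    = refl
insertAt-last-inject₁ {n = suc n} xs v (fsuc i) = insertAt-last-inject₁ (Vector.tail xs) v i

insertAt-last-below : ∀ {A : Set} (P : A → Set) {n} (xs : Vector.Vector A n) v (i : Fin n) →
  (∀ j → j Fin.< i → ¬ P (xs j)) → ∀ j → j Fin.< Fin.inject₁ i → ¬ P (insertAt xs (Fin.fromℕ n) v j)
insertAt-last-below P {suc n} xs v (fsuc i) below fzero    _         = below fzero z<s
insertAt-last-below P {suc n} xs v (fsuc i) below (fsuc j) (s<s j<i) =
  insertAt-last-below P (Vector.tail xs) v i (λ j' j'<i → below (fsuc j') (s<s j'<i)) j j<i

module _ {q : ℕ} .{{_ : NonZero q}} where

  negate : ℕ → Fin q
  negate t = ((q ∸ 1) * t) mod q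

  +-negate : ∀ t → t + toℕ (negate t) ≡ 0 [mod q ]
  +-negate t = mod-trans (+-congˡ-mod t (toℕ-mod ((q ∸ 1) * t) q)) (x+[m∸1]*x≡0-mod t)

  dot-onto : ∀ {m} (b : ProjPt q m) t → Σ[ a ∈ Vecʳ q m ] dot q m a (vec b) ≡ t [mod q ]
  dot-onto {m} b t = a , (begin
    dot q m a (vec b)                               ≡⟨ sumFin≡sum m (λ i → toℕ (a i) * toℕ (vec b i)) ⟩
    sum (λ i → toℕ (a i) * toℕ (vec b i))
      ≈⟨ sum-cong-mod (λ i → *-congʳ-mod (toℕ (vec b i)) (toℕ-mod (δ i (idx b) * t) q)) ⟩
    sum (λ i → δ i (idx b) * t * toℕ (vec b i))     ≡⟨ sum-cong-≗ (λ i → ℕₚ.*-assoc (δ i (idx b)) t (toℕ (vec b i))) ⟩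
    sum (λ i → δ i (idx b) * (t * toℕ (vec b i)))   ≡⟨ sum-δ (idx b) (λ i → t * toℕ (vec b i)) ⟩
    t * toℕ (vec b (idx b))                         ≈⟨ *-congˡ-mod t (Equivalence.to EqR⇔≡-mod (normed b)) ⟩
    t * 1                                           ≡⟨ ℕₚ.*-identityʳ t ⟩
    t                                               ∎)
    where
    open ≡-mod-Reasoning q
    a : Vecʳ q m
    a i = (δ i (idx b) * t) mod q

  extend : ∀ {m} → ProjPt q m → Fin q → ProjPt q (suc m)
  extend {m} b u = proj (insertAt (vec b) (Fin.fromℕ m) u) (Fin.inject₁ (idx b))
    (subst (IsUnit q) (sym (insertAt-last-inject₁ (vec b) u (idx b))) (idxUnit b))
    (insertAt-last-below (IsUnit q) (vec b) u (idx b) (before b))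
    (subst (λ z → EqR q (toℕ z) 1) (sym (insertAt-last-inject₁ (vec b) u (idx b))) (normed b))

  AStar≡WStar : ∀ {m} (a : Vecʳ q m) (b : ProjPt q m) x →
    WStar q (suc m) (extend b (negate (dot q m a (vec b)))) (insertAt x (Fin.fromℕ m) (1 mod q)) ≡ AStar q m (a , b) x
  AStar≡WStar {m} a b x = indicT-cong {b = extend b (negate t)} {b} {insertAt x (Fin.fromℕ m) (1 mod q)} {x}
    (+≡0-mod-unique (+-negate t) ⇔-∘ ≡-mod-resp-⇔ D≡X+N mod-refl)
    where
    t N X : ℕ
    t = dot q m a (vec b)
    N = toℕ (negate t)
    X = dot q m x (vec b)
    D≡X+N : dot q (suc m) (insertAt x (Fin.fromℕ m) (1 mod q)) (insertAt (vec b) (Fin.fromℕ m) (negate t)) ≡ X + N [mod q ]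
    D≡X+N = begin
      dot q (suc m) (insertAt x (Fin.fromℕ m) (1 mod q)) (insertAt (vec b) (Fin.fromℕ m) (negate t))
                           ≡⟨ dot-insertAt x (vec b) (Fin.fromℕ m) (1 mod q) (negate t) ⟩
      toℕ (1 mod q) * N + X ≈⟨ +-congʳ-mod X (*-congʳ-mod N (toℕ-mod 1 q)) ⟩
      1 * N + X            ≡⟨ trans (cong (_+ X) (ℕₚ.*-identityˡ N)) (ℕₚ.+-comm N X) ⟩
      X + N                ∎
      where open ≡-mod-Reasoning q

  scale : ∀ {m} → ℕ → Vecʳ q m → Vecʳ q m
  scale u v i = (u * toℕ (v i)) mod q

  dot-scale : ∀ {m} u (v b : Vecʳ q m) → dot q m (scale u v) b ≡ u * dot q m v b [mod q ]
  dot-scale {m} u v b = begin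
    dot q m (scale u v) b                       ≡⟨ sumFin≡sum m (λ i → toℕ (scale u v i) * toℕ (b i)) ⟩
    sum (λ i → toℕ (scale u v i) * toℕ (b i))
      ≈⟨ sum-cong-mod (λ i → *-congʳ-mod (toℕ (b i)) (toℕ-mod (u * toℕ (v i)) q)) ⟩
    sum (λ i → u * toℕ (v i) * toℕ (b i))       ≡⟨ sum-cong-≗ (λ i → ℕₚ.*-assoc u (toℕ (v i)) (toℕ (b i))) ⟩
    sum (λ i → u * (toℕ (v i) * toℕ (b i)))     ≡⟨ *-distribˡ-sum u (λ i → toℕ (v i) * toℕ (b i)) ⟨
    u * sum (λ i → toℕ (v i) * toℕ (b i))       ≡⟨ cong (u *_) (sumFin≡sum m (λ i → toℕ (v i) * toℕ (b i))) ⟨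
    u * dot q m v b                             ∎
    where open ≡-mod-Reasoning q

module _ {p : ℕ} (p-prime : Prime p) (k n : ℕ) where

  private
    q : ℕ
    q = p ^ k
    instance
      q≢0 : NonZero q
      q≢0 = ℕₚ.m^n≢0 p k {{prime⇒nonZero p-prime}}

  position : Fin 2 → Fin (suc (suc n))
  position c = c ↑ˡ n

  -- coord is never the first invertible coordinate of b, so deleting it leaves a point of ℙR^n.
  record Splitting (b : ProjPt q (suc (suc n))) : Set where
    field
      coord    : Fin 2
      rest     : ProjPt q (suc n)
      vec-rest : ∀ i → vec rest i ≡ removeAt (vec b) (position coord) i

  splitting : ∀ b → Splitting b
  splitting b = split-at (idx b) refl
    where
    split-at : ∀ i → idx b ≡ i → Splitting b
    split-at fzero idx≡0 = record
      { coord    = fsuc fzero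
      ; rest     = proj (removeAt (vec b) (fsuc fzero)) fzero
                        (subst (IsUnit q ∘ vec b) idx≡0 (idxUnit b)) (λ _ ())
                        (subst (λ i → EqR q (toℕ (vec b i)) 1) idx≡0 (normed b))
      ; vec-rest = λ _ → refl
      }
    split-at (fsuc i) idx≡1+i = record
      { coord    = fzero
      ; rest     = proj (removeAt (vec b) fzero) i
                        (subst (IsUnit q ∘ vec b) idx≡1+i (idxUnit b))
                        (λ j j<i → before b (fsuc j) (subst (fsuc j Fin.<_) (sym idx≡1+i) (s<s j<i)))
                        (subst (λ i → EqR q (toℕ (vec b i)) 1) idx≡1+i (normed b))
      ; vec-rest = λ _ → refl
      }

  private
    decomposition : (s : Fin q) → PrimePowerTimesUnit p k (toℕ s)
    decomposition s = unit-times-prime-power p-prime k (toℕ s) (Finₚ.toℕ<n s)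

  valuation : Fin 2 → Vecʳ q (suc (suc n)) → Fin (suc k)
  valuation c y = PrimePowerTimesUnit.exponent (decomposition (y (position c)))

  normalise : Fin 2 → Vecʳ q (suc (suc n)) → Vecʳ q (suc n)
  normalise c y = scale (PrimePowerTimesUnit.unit⁻¹ (decomposition (y (position c)))) (removeAt y (position c))

  sector : ProjPt q (suc (suc n)) → Fin 2
  sector b = Splitting.coord (splitting b)

  affine-row : ProjPt q (suc (suc n)) → Fin (suc k) → Vecʳ q (suc n) × ProjPt q (suc n)
  affine-row b j = proj₁ (dot-onto b' (toℕ (negate {q} (p ^ toℕ j * toℕ (vec b (position (sector b))))))) , b'
    where
    b' : ProjPt q (suc n)
    b' = Splitting.rest (splitting b)

  WStar≡AStar : ∀ b y → WStar q (suc (suc n)) b y ≡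
    AStar q (suc n) (affine-row b (valuation (sector b) y)) (normalise (sector b) y)
  WStar≡AStar b y = indicT-cong {b = b} {b'} {y} {normalise c y}
    (≡-mod-resp-⇔ (mod-sym normalised-dot) mod-refl ⇔-∘
     (+≡0-mod-unique t+Pβ≡0 ⇔-∘
      (unit-rescaling {P = P} {unit} {unit⁻¹} {β} {X} factorisation unit-inverse ⇔-∘
       ≡-mod-resp-⇔ (mod-reflexive D≡sβ+X) mod-refl)))
    where
    c : Fin 2
    c = sector b
    b' : ProjPt q (suc n)
    b' = Splitting.rest (splitting b)
    s β X : ℕ
    s = toℕ (y (position c))
    β = toℕ (vec b (position c))
    X = dot q (suc n) (removeAt y (position c)) (vec b')
    open PrimePowerTimesUnit (decomposition (y (position c)))
    P : ℕ
    P = p ^ toℕ exponent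
    onto : Σ[ a ∈ Vecʳ q (suc n) ] dot q (suc n) a (vec b') ≡ toℕ (negate {q} (P * β)) [mod q ]
    onto = dot-onto b' (toℕ (negate {q} (P * β)))
    t : ℕ
    t = dot q (suc n) (proj₁ onto) (vec b')
    D≡sβ+X : dot q (suc (suc n)) y (vec b) ≡ s * β + X
    D≡sβ+X = trans (dot-removeAt y (vec b) (position c))
      (cong (_+_ (s * β)) (dot-cong {x = removeAt y (position c)} (λ _ → refl) (sym ∘ Splitting.vec-rest (splitting b))))
    t+Pβ≡0 : t + P * β ≡ 0 [mod q ]
    t+Pβ≡0 = mod-trans (+-congʳ-mod (P * β) (proj₂ onto)) N+Pβ≡0
      where
      N+Pβ≡0 : toℕ (negate {q} (P * β)) + P * β ≡ 0 [mod q ]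
      N+Pβ≡0 = subst (_≡ 0 [mod q ]) (ℕₚ.+-comm (P * β) (toℕ (negate {q} (P * β)))) (+-negate {q} (P * β))
    normalised-dot : dot q (suc n) (normalise c y) (vec b') ≡ unit⁻¹ * X [mod q ]
    normalised-dot = dot-scale unit⁻¹ (removeAt y (position c)) (vec b')

proposition2p3 : (p k n : ℕ) → Prime p → 2 ≤ n →
    (rA rW : ℕ) →
    HasRank p (AStar (p ^ k) n) rA →
    HasRank p (WStar (p ^ k) (suc n)) rW →
    (rA ≤ rW) × (rW ≤ 2 * (suc k) * rA)
proposition2p3 p k (suc n) p-prime (s≤s _) rA rW rank-A rank-W =
  rank-≤-embedding (AStar q (suc n)) (WStar q (suc (suc n))) offset-row one-column
    (λ (a , b) x → AStar≡WStar a b x) rank-A rank-W ,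
  rank-≤-piecewise p-prime (AStar q (suc n)) (WStar q (suc (suc n)))
    (valuation p-prime k n) (normalise p-prime k n) (sector p-prime k n) (affine-row p-prime k n)
    (WStar≡AStar p-prime k n) rank-A rank-W
  where
  q : ℕ
  q = p ^ k
  instance
    q≢0 : NonZero q
    q≢0 = ℕₚ.m^n≢0 p k {{prime⇒nonZero p-prime}}
  offset-row : Vecʳ q (suc n) × ProjPt q (suc n) → ProjPt q (suc (suc n))
  offset-row (a , b) = extend b (negate (dot q (suc n) a (vec b)))
  one-column : Vecʳ q (suc n) → Vecʳ q (suc (suc n))
  one-column x = insertAt x (Fin.fromℕ (suc n)) (1 mod q)
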